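{- Let $n\ge k\ge 2$ be integers and let $x_1,\dots,x_k$ be positive integers with $\sum_{i=1}^k x_i=n$. Then $$n-1\le \sum_{i=1}^{k-1}x_ix_{i+1}\le \begin{cases}\lfloor n/2\rfloor\cdot\lceil n/2\rceil & \text{if } k=2,3,\\ ab+k-5 & \text{if } k\ge 4,\end{cases}$$ where $a=\lfloor (n-k+4)/2\rfloor$ and $b=\lceil (n-k+4)/2\rceil$. Moreover, for every such $n$ and $k$, both the lower bound and the upper bound are attained by some choice of positive integers $x_1,\dots,x_k$ summing to $n$. -}

module Defs where

open import Data.Nat using (ℕ; zero; suc; _+_; _*_; _∸_; _≤_; ⌊_/2⌋; ⌈_/2⌉)
open import Data.Fin using (Fin; zero; suc)
open import Data.Product using (_×_)
open import Relation.Binary.PropositionalEquality using (_≡_)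

sumF : ∀ {k} → (Fin k → ℕ) → ℕ
sumF {zero}  x = 0
sumF {suc k} x = x zero + sumF (λ i → x (suc i))

adjSum : ∀ {k} → (Fin k → ℕ) → ℕ
adjSum {zero}        x = 0
adjSum {suc zero}    x = 0
adjSum {suc (suc k)} x = x zero * x (suc zero) + adjSum (λ i → x (suc i))

Admissible : (n k : ℕ) → (Fin k → ℕ) → Set
Admissible n k x = (∀ i → 1 ≤ x i) × sumF x ≡ n

-- the upper bound: ⌊n/2⌋⌈n/2⌉ for k = 2,3 ; ab + k - 5 for k ≥ 4,
-- a = ⌊(n-k+4)/2⌋, b = ⌈(n-k+4)/2⌉  (n ≥ k so n-k+4 is truncation-free)
upper : ℕ → ℕ → ℕ
upper n 0 = ⌊ n /2⌋ * ⌈ n /2⌉   -- unused (k ≥ 2)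
upper n 1 = ⌊ n /2⌋ * ⌈ n /2⌉   -- unused (k ≥ 2)
upper n 2 = ⌊ n /2⌋ * ⌈ n /2⌉
upper n 3 = ⌊ n /2⌋ * ⌈ n /2⌉
upper n (suc (suc (suc (suc j)))) =
  ⌊ (n ∸ k + 4) /2⌋ * ⌈ (n ∸ k + 4) /2⌉ + k ∸ 5
  where k = suc (suc (suc (suc j)))

-- Lower bound: for positive entries xᵢ ≤ xᵢxᵢ₊₁, and p + q ≤ 1 + pq for the last pair.
-- Upper bound: each product xᵢxᵢ₊₁ pairs an even-indexed entry with an odd-indexed one, so the
-- adjacent sum is at most (Σ even)(Σ odd) ≤ ⌊n/2⌋⌈n/2⌉, which settles k = 2, 3. For k ≥ 4 write
-- xᵢ = 1 + yᵢ; then Σ xᵢxᵢ₊₁ = Σ yᵢyᵢ₊₁ + 2Σ yᵢ − y₁ − yₖ + (k − 1), and bounding Σ yᵢyᵢ₊₁ by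
-- ⌊T/2⌋⌈T/2⌉ with T = Σ yᵢ = n − k gives ab + k − 5. The bounds are attained by (n − k + 1, 1, …, 1)
-- and by (⌊n/2⌋, ⌈n/2⌉), (1, ⌊n/2⌋, ⌈n/2⌉ − 1), (1, a − 1, b − 1, 1, …, 1) respectively.
module Submission where

open import Defs
open import Data.Nat using (ℕ; zero; suc; pred; _+_; _*_; _∸_; _≤_; z≤n; s≤s; ⌊_/2⌋; ⌈_/2⌉; >-nonZero)
open import Data.Nat.Properties
open import Data.Nat.Tactic.RingSolver using (solve-∀)
open import Data.Fin using (Fin; zero; suc; fromℕ)
open import Data.Vec.Functional using ([]; _∷_; replicate; tail)
open import Data.Product using (_×_; ∃; _,_)
open import Function using (_∘_; _∘′_)
open import Relation.Binary.PropositionalEquality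

halfProduct : ℕ → ℕ
halfProduct m = ⌊ m /2⌋ * ⌈ m /2⌉

suc*suc : ∀ a b → suc a * suc b ≡ a * b + (a + b) + 1
suc*suc = solve-∀

halfProduct-+2 : ∀ m → halfProduct (2 + m) ≡ halfProduct m + m + 1
halfProduct-+2 m = begin
  suc ⌊ m /2⌋ * suc ⌈ m /2⌉                   ≡⟨ suc*suc ⌊ m /2⌋ ⌈ m /2⌉ ⟩
  halfProduct m + (⌊ m /2⌋ + ⌈ m /2⌉) + 1     ≡⟨ cong (λ s → halfProduct m + s + 1) (⌊n/2⌋+⌈n/2⌉≡n m) ⟩
  halfProduct m + m + 1                       ∎
  where open ≡-Reasoning

*≤halfProduct : ∀ a b → a * b ≤ halfProduct (a + b)
*≤halfProduct zero    b       = z≤n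
*≤halfProduct (suc a) zero    = ≤-trans (≤-reflexive (*-zeroʳ a)) z≤n
*≤halfProduct (suc a) (suc b) = begin
  suc a * suc b                          ≡⟨ suc*suc a b ⟩
  a * b + (a + b) + 1                    ≤⟨ +-monoˡ-≤ 1 (+-monoˡ-≤ (a + b) (*≤halfProduct a b)) ⟩
  halfProduct (a + b) + (a + b) + 1      ≡⟨ halfProduct-+2 (a + b) ⟨
  halfProduct (2 + (a + b))              ≡⟨ cong (halfProduct ∘ suc) (+-suc a b) ⟨
  halfProduct (suc a + suc b)            ∎
  where open ≤-Reasoning

sumF-cong : ∀ {k} {x y : Fin k → ℕ} → x ≗ y → sumF x ≡ sumF y
sumF-cong {zero}  x≗y = refl
sumF-cong {suc k} x≗y = cong₂ _+_ (x≗y zero) (sumF-cong (x≗y ∘ suc))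

adjSum-cong : ∀ {k} {x y : Fin k → ℕ} → x ≗ y → adjSum x ≡ adjSum y
adjSum-cong {zero}        x≗y = refl
adjSum-cong {suc zero}    x≗y = refl
adjSum-cong {suc (suc k)} x≗y =
  cong₂ _+_ (cong₂ _*_ (x≗y zero) (x≗y (suc zero))) (adjSum-cong (x≗y ∘ suc))

sumF-suc : ∀ {k} (y : Fin k → ℕ) → sumF (suc ∘ y) ≡ k + sumF y
sumF-suc {zero}  y = refl
sumF-suc {suc k} y = cong suc (begin
  y zero + sumF (suc ∘ tail y)           ≡⟨ cong (y zero +_) (sumF-suc (tail y)) ⟩
  y zero + (k + sumF (tail y))           ≡⟨ +-assoc (y zero) k _ ⟨
  y zero + k + sumF (tail y)             ≡⟨ cong (_+ sumF (tail y)) (+-comm (y zero) k) ⟩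
  k + y zero + sumF (tail y)             ≡⟨ +-assoc k (y zero) _ ⟩
  k + (y zero + sumF (tail y))           ∎)
  where open ≡-Reasoning

sumF-replicate : ∀ m c → sumF (replicate m c) ≡ m * c
sumF-replicate zero    c = refl
sumF-replicate (suc m) c = cong (c +_) (sumF-replicate m c)

adjSum-replicate : ∀ m c → adjSum (replicate (suc m) c) ≡ m * (c * c)
adjSum-replicate zero    c = refl
adjSum-replicate (suc m) c = cong (c * c +_) (adjSum-replicate m c)

evenSum oddSum : ∀ {k} → (Fin k → ℕ) → ℕ
evenSum {zero}  y = 0
evenSum {suc k} y = y zero + oddSum (tail y)
oddSum  {zero}  y = 0
oddSum  {suc k} y = evenSum (tail y)

evenSum+oddSum≡sumF : ∀ {k} (y : Fin k → ℕ) → evenSum y + oddSum y ≡ sumF y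
evenSum+oddSum≡sumF {zero}  y = refl
evenSum+oddSum≡sumF {suc k} y = begin
  y zero + oddSum (tail y) + evenSum (tail y)     ≡⟨ +-assoc (y zero) _ _ ⟩
  y zero + (oddSum (tail y) + evenSum (tail y))   ≡⟨ cong (y zero +_) (+-comm (oddSum (tail y)) _) ⟩
  y zero + (evenSum (tail y) + oddSum (tail y))   ≡⟨ cong (y zero +_) (evenSum+oddSum≡sumF (tail y)) ⟩
  y zero + sumF (tail y)                          ∎
  where open ≡-Reasoning

adjSum≤evenSum*oddSum : ∀ {k} (y : Fin k → ℕ) → adjSum y ≤ evenSum y * oddSum y
adjSum≤evenSum*oddSum {zero}        y = z≤n
adjSum≤evenSum*oddSum {suc zero}    y = z≤n
adjSum≤evenSum*oddSum {suc (suc k)} y = begin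
  y₀ * y₁ + adjSum t                   ≤⟨ +-monoʳ-≤ (y₀ * y₁) (adjSum≤evenSum*oddSum t) ⟩
  y₀ * y₁ + evenSum t * oddSum t       ≤⟨ +-monoˡ-≤ _ (*-monoʳ-≤ y₀ (m≤m+n y₁ (oddSum (tail t)))) ⟩
  y₀ * evenSum t + evenSum t * oddSum t
    ≡⟨ cong (y₀ * evenSum t +_) (*-comm (evenSum t) (oddSum t)) ⟩
  y₀ * evenSum t + oddSum t * evenSum t ≡⟨ *-distribʳ-+ (evenSum t) y₀ (oddSum t) ⟨
  (y₀ + oddSum t) * evenSum t           ∎
  where
  open ≤-Reasoning
  y₀ = y zero
  y₁ = y (suc zero)
  t = tail y

adjSum≤halfProduct : ∀ {k} (y : Fin k → ℕ) → adjSum y ≤ halfProduct (sumF y)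
adjSum≤halfProduct y = begin
  adjSum y                                   ≤⟨ adjSum≤evenSum*oddSum y ⟩
  evenSum y * oddSum y                       ≤⟨ *≤halfProduct (evenSum y) (oddSum y) ⟩
  halfProduct (evenSum y + oddSum y)         ≡⟨ cong halfProduct (evenSum+oddSum≡sumF y) ⟩
  halfProduct (sumF y)                       ∎
  where open ≤-Reasoning

adjSum-suc : ∀ {k} (y : Fin (suc k) → ℕ) →
  adjSum (suc ∘ y) + y zero + y (fromℕ k) ≡ adjSum y + 2 * sumF y + k
adjSum-suc {zero}  y = double (y zero)
  where
  double : ∀ a → a + a ≡ 2 * (a + 0) + 0
  double = solve-∀
adjSum-suc {suc k} y = begin
  suc y₀ * suc y₁ + adjSum (suc ∘ t) + y₀ + t (fromℕ k)
    ≡⟨ regroup y₀ y₁ (adjSum (suc ∘ t)) (t (fromℕ k)) ⟩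
  y₀ * y₁ + 2 * y₀ + 1 + (adjSum (suc ∘ t) + y₁ + t (fromℕ k))
    ≡⟨ cong (y₀ * y₁ + 2 * y₀ + 1 +_) (adjSum-suc t) ⟩
  y₀ * y₁ + 2 * y₀ + 1 + (adjSum t + 2 * sumF t + k)
    ≡⟨ collect y₀ y₁ (adjSum t) (sumF t) k ⟩
  y₀ * y₁ + adjSum t + 2 * (y₀ + sumF t) + suc k
    ∎
  where
  open ≡-Reasoning
  y₀ = y zero
  y₁ = y (suc zero)
  t = tail y
  regroup : ∀ a b s l → suc a * suc b + s + a + l ≡ a * b + 2 * a + 1 + (s + b + l)
  regroup = solve-∀
  collect : ∀ a b s σ k → a * b + 2 * a + 1 + (s + 2 * σ + k) ≡ a * b + s + 2 * (a + σ) + suc k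
  collect = solve-∀

adjSum-suc≤ : ∀ {k} (y : Fin (suc k) → ℕ) →
  adjSum (suc ∘ y) ≤ halfProduct (sumF y) + 2 * sumF y + k
adjSum-suc≤ {k} y = begin
  adjSum (suc ∘ y)                                  ≤⟨ m≤m+n _ (y zero) ⟩
  adjSum (suc ∘ y) + y zero                         ≤⟨ m≤m+n _ (y (fromℕ k)) ⟩
  adjSum (suc ∘ y) + y zero + y (fromℕ k)           ≡⟨ adjSum-suc y ⟩
  adjSum y + 2 * sumF y + k                         ≤⟨ +-monoˡ-≤ k (+-monoˡ-≤ _ (adjSum≤halfProduct y)) ⟩
  halfProduct (sumF y) + 2 * sumF y + k             ∎
  where open ≤-Reasoning

upper-≥4 : ∀ j T → upper (4 + j + T) (4 + j) ≡ halfProduct T + 2 * T + (3 + j)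
upper-≥4 j T = begin
  halfProduct ((j + T) ∸ j + 4) + (4 + j) ∸ 5
    ≡⟨ cong (λ m → halfProduct (m + 4) + (4 + j) ∸ 5) (m+n∸m≡n j T) ⟩
  halfProduct (T + 4) + (4 + j) ∸ 5
    ≡⟨ cong (λ m → halfProduct m + (4 + j) ∸ 5) (+-comm T 4) ⟩
  halfProduct (4 + T) + (4 + j) ∸ 5
    ≡⟨ cong (λ h → h + (4 + j) ∸ 5) (halfProduct-+2 (2 + T)) ⟩
  halfProduct (2 + T) + (2 + T) + 1 + (4 + j) ∸ 5
    ≡⟨ cong (λ h → h + (2 + T) + 1 + (4 + j) ∸ 5) (halfProduct-+2 T) ⟩
  halfProduct T + T + 1 + (2 + T) + 1 + (4 + j) ∸ 5
    ≡⟨ cong (_∸ 5) (collect (halfProduct T) T j) ⟩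
  halfProduct T + 2 * T + (3 + j)
    ∎
  where
  open ≡-Reasoning
  collect : ∀ h T j → h + T + 1 + (2 + T) + 1 + (4 + j) ≡ 5 + (h + 2 * T + (3 + j))
  collect = solve-∀

upper-bound : ∀ {n k} → 2 ≤ k → (x : Fin k → ℕ) → Admissible n k x → adjSum x ≤ upper n k
upper-bound {k = 1} (s≤s ()) x _
upper-bound {k = 2} _        x (_ , refl) = adjSum≤halfProduct x
upper-bound {k = 3} _        x (_ , refl) = adjSum≤halfProduct x
upper-bound {k = suc (suc (suc (suc j)))} _ x (pos , refl) = begin
  adjSum x                                       ≡⟨ adjSum-cong {y = suc ∘′ y} x≗suc∘y ⟩
  adjSum (suc ∘′ y)                              ≤⟨ adjSum-suc≤ y ⟩
  halfProduct (sumF y) + 2 * sumF y + (3 + j)    ≡⟨ upper-≥4 j (sumF y) ⟨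
  upper (4 + j + sumF y) (4 + j)                 ≡⟨ cong (λ m → upper m (4 + j)) (sumF-suc y) ⟨
  upper (sumF (suc ∘′ y)) (4 + j)                ≡⟨ cong (λ m → upper m (4 + j)) (sumF-cong {y = suc ∘′ y} x≗suc∘y) ⟨
  upper (sumF x) (4 + j)                         ∎
  where
  open ≤-Reasoning
  y : Fin (4 + j) → ℕ
  y = pred ∘′ x
  x≗suc∘y : x ≗ suc ∘′ y
  x≗suc∘y i = sym (suc-pred (x i) {{>-nonZero (pos i)}})

+≤suc-* : ∀ {p q} → 1 ≤ p → 1 ≤ q → p + q ≤ suc (p * q)
+≤suc-* {suc a} {suc b} _ _ = begin
  suc a + suc b               ≡⟨ +-suc (suc a) b ⟩
  2 + (a + b)                 ≤⟨ +-monoʳ-≤ 2 (m≤m+n (a + b) (a * b)) ⟩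
  2 + (a + b + a * b)         ≡⟨ expand a b ⟨
  suc (suc a * suc b)         ∎
  where
  open ≤-Reasoning
  expand : ∀ a b → suc (suc a * suc b) ≡ 2 + (a + b + a * b)
  expand = solve-∀

sumF≤suc-adjSum : ∀ {k} (x : Fin (2 + k) → ℕ) → (∀ i → 1 ≤ x i) → sumF x ≤ suc (adjSum x)
sumF≤suc-adjSum {zero} x pos = begin
  x zero + (x (suc zero) + 0)           ≡⟨ cong (x zero +_) (+-identityʳ _) ⟩
  x zero + x (suc zero)                 ≤⟨ +≤suc-* (pos zero) (pos (suc zero)) ⟩
  suc (x zero * x (suc zero))           ≡⟨ cong suc (+-identityʳ _) ⟨
  suc (x zero * x (suc zero) + 0)       ∎
  where open ≤-Reasoning
sumF≤suc-adjSum {suc k} x pos = begin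
  x zero + sumF (tail x)                            ≤⟨ +-mono-≤ x₀≤x₀*x₁ (sumF≤suc-adjSum (tail x) (pos ∘ suc)) ⟩
  x zero * x (suc zero) + suc (adjSum (tail x))     ≡⟨ +-suc _ _ ⟩
  suc (x zero * x (suc zero) + adjSum (tail x))     ∎
  where
  open ≤-Reasoning
  x₀≤x₀*x₁ : x zero ≤ x zero * x (suc zero)
  x₀≤x₀*x₁ = m≤m*n (x zero) (x (suc zero)) {{>-nonZero (pos (suc zero))}}

lower-bound : ∀ {n k} → 2 ≤ k → (x : Fin k → ℕ) → Admissible n k x → n ∸ 1 ≤ adjSum x
lower-bound {k = 1}           (s≤s ()) x _
lower-bound {k = suc (suc k)} _        x (pos , refl) = ∸-monoˡ-≤ 1 (sumF≤suc-adjSum x pos)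

Attains : (n k v : ℕ) → Set
Attains n k v = ∃ λ (x : Fin k → ℕ) → Admissible n k x × adjSum x ≡ v

lower-attained : ∀ {k} → 2 ≤ k → ∀ T → Attains (k + T) k (k + T ∸ 1)
lower-attained {1}           (s≤s ()) T
lower-attained {suc (suc j)} _ T = suc T ∷ replicate (suc j) 1 , (pos , sum) , adj
  where
  pos : ∀ i → 1 ≤ (suc T ∷ replicate (suc j) 1) i
  pos zero    = s≤s z≤n
  pos (suc i) = s≤s z≤n
  sum : suc T + sumF (replicate (suc j) 1) ≡ suc (suc j + T)
  sum = trans (cong (suc T +_) (sumF-replicate (suc j) 1)) (rearrange T j)
    where
    rearrange : ∀ T j → suc T + suc j * 1 ≡ suc (suc j + T)
    rearrange = solve-∀
  adj : suc T * 1 + adjSum (replicate (suc j) 1) ≡ suc (j + T)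
  adj = trans (cong (suc T * 1 +_) (adjSum-replicate j 1)) (rearrange T j)
    where
    rearrange : ∀ T j → suc T * 1 + j * 1 ≡ suc (j + T)
    rearrange = solve-∀

upper-attained : ∀ {k} → 2 ≤ k → ∀ T → Attains (k + T) k (upper (k + T) k)
upper-attained {1} (s≤s ()) T
upper-attained {2} _ T = ⌊ n /2⌋ ∷ ⌈ n /2⌉ ∷ [] , (pos , sum) , +-identityʳ _
  where
  n = 2 + T
  pos : ∀ i → 1 ≤ (⌊ n /2⌋ ∷ ⌈ n /2⌉ ∷ []) i
  pos zero       = s≤s z≤n
  pos (suc zero) = s≤s z≤n
  sum : ⌊ n /2⌋ + (⌈ n /2⌉ + 0) ≡ n
  sum = trans (cong (⌊ n /2⌋ +_) (+-identityʳ _)) (⌊n/2⌋+⌈n/2⌉≡n n)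
upper-attained {3} _ T = 1 ∷ ⌊ n /2⌋ ∷ ⌈ n /2⌉ ∸ 1 ∷ [] , (pos , sum) , adj
  where
  n = 3 + T
  p = ⌊ T /2⌋
  q = ⌈ T /2⌉
  -- ⌊ n /2⌋ and ⌈ n /2⌉ ∸ 1 compute to suc q and suc p.
  pos : ∀ i → 1 ≤ (1 ∷ ⌊ n /2⌋ ∷ ⌈ n /2⌉ ∸ 1 ∷ []) i
  pos zero             = s≤s z≤n
  pos (suc zero)       = s≤s z≤n
  pos (suc (suc zero)) = s≤s z≤n
  sum : 1 + (suc q + (suc p + 0)) ≡ n
  sum = trans (rearrange p q) (cong (3 +_) (⌊n/2⌋+⌈n/2⌉≡n T))
    where
    rearrange : ∀ p q → 1 + (suc q + (suc p + 0)) ≡ 3 + (p + q)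
    rearrange = solve-∀
  adj : 1 * suc q + (suc q * suc p + 0) ≡ suc q * suc (suc p)
  adj = factor (suc q) (suc p)
    where
    factor : ∀ u v → 1 * u + (u * v + 0) ≡ u * suc v
    factor = solve-∀
upper-attained {suc (suc (suc (suc j)))} _ T = x , (pos , sum) , adj
  where
  p = ⌊ T /2⌋
  q = ⌈ T /2⌉
  x : Fin (4 + j) → ℕ
  x = 1 ∷ suc p ∷ suc q ∷ replicate (suc j) 1
  pos : ∀ i → 1 ≤ x i
  pos zero                   = s≤s z≤n
  pos (suc zero)             = s≤s z≤n
  pos (suc (suc zero))       = s≤s z≤n
  pos (suc (suc (suc i)))    = s≤s z≤n
  sum : sumF x ≡ 4 + j + T
  sum = begin
    1 + (suc p + (suc q + sumF (replicate (suc j) 1)))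
      ≡⟨ cong (λ s → 1 + (suc p + (suc q + s))) (sumF-replicate (suc j) 1) ⟩
    1 + (suc p + (suc q + suc j * 1))   ≡⟨ rearrange p q j ⟩
    4 + j + (p + q)                     ≡⟨ cong (4 + j +_) (⌊n/2⌋+⌈n/2⌉≡n T) ⟩
    4 + j + T                           ∎
    where
    open ≡-Reasoning
    rearrange : ∀ p q j → 1 + (suc p + (suc q + suc j * 1)) ≡ 4 + j + (p + q)
    rearrange = solve-∀
  adj : adjSum x ≡ upper (4 + j + T) (4 + j)
  adj = begin
    1 * suc p + (suc p * suc q + (suc q * 1 + adjSum (replicate (suc j) 1)))
      ≡⟨ cong (λ s → 1 * suc p + (suc p * suc q + (suc q * 1 + s))) (adjSum-replicate j 1) ⟩
    1 * suc p + (suc p * suc q + (suc q * 1 + j * 1))   ≡⟨ rearrange p q j ⟩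
    halfProduct T + 2 * (p + q) + (3 + j)               ≡⟨ cong (λ s → halfProduct T + 2 * s + (3 + j)) (⌊n/2⌋+⌈n/2⌉≡n T) ⟩
    halfProduct T + 2 * T + (3 + j)                     ≡⟨ upper-≥4 j T ⟨
    upper (4 + j + T) (4 + j)                           ∎
    where
    open ≡-Reasoning
    rearrange : ∀ p q j → 1 * suc p + (suc p * suc q + (suc q * 1 + j * 1)) ≡ p * q + 2 * (p + q) + (3 + j)
    rearrange = solve-∀

lemma3 : (n k : ℕ) → 2 ≤ k → k ≤ n →
    ((x : Fin k → ℕ) → Admissible n k x →
        (n ∸ 1 ≤ adjSum x) × (adjSum x ≤ upper n k))
    × (∃ λ (x : Fin k → ℕ) → Admissible n k x × adjSum x ≡ n ∸ 1)
    × (∃ λ (x : Fin k → ℕ) → Admissible n k x × adjSum x ≡ upper n k)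
lemma3 n k 2≤k k≤n with m≤n⇒∃[o]m+o≡n k≤n
... | T , refl =
    (λ x admissible → lower-bound 2≤k x admissible , upper-bound 2≤k x admissible)
  , lower-attained 2≤k T
  , upper-attained 2≤k T
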